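{- Let $m$ be a nonnegative integer. If $G$ is the $(0,m)$--position (or the $(m,0)$--position) and $H$ is the alternating blue-red hackenbush string of size $m$ with a blue edge at the base when there are edges, then $G\cong H$ and $G=H_m=\frac{2^m-(-1)^m}{3\times 2^{m-1}}$.
   Context: Partisan chocolate game: a component is a rectangular chocolate bar of square cells; the bottom-left cell is poisoned (black), the others are colored blue and red in checkerboard fashion with the cells orthogonally adjacent to the poisoned one blue. Left may cut along a vertical line if the top square of the column immediately to the right of that line is blue, or along a horizontal line if the rightmost square of the row just above that line is blue; Right may make the same moves when the corresponding square is red. After a cut, the player eats the portion not containing the poisoned square. Normal play. The bar with $n+1$ columns and $m+1$ rows is denoted $(n,m)$. Blue-red hackenbush: positions are graphs of blue and red edges connected to the ground; Left removes a blue edge, Right a red edge, and edges disconnected from the ground are removed. $G\cong H$ means the game trees are isomorphic; $=$ denotes game equivalence. $H_m=\frac{2^m-(-1)^m}{3\times 2^{m-1}}$ is the value of the alternating string of size $m$. -}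

module Defs where

open import Data.Nat as ℕ using (ℕ; zero; suc; _+_)
open import Data.Integer as ℤ using (ℤ; +_; -[1+_])
open import Data.Rational as ℚ using (ℚ; ½)
open import Data.Fin using (Fin)
open import Data.List using (List; []; _∷_; [_]; length; lookup; upTo; concatMap; map; _++_)
open import Data.Bool using (Bool; true; false; if_then_else_)
open import Data.Product using (Σ; _×_; _,_; ∃; ∃-syntax)
open import Data.Sum using (_⊎_)
open import Data.Unit using (⊤)
open import Function.Bundles using (_↔_; Inverse)
open import Relation.Binary.PropositionalEquality using (_≡_)

-- A game has a finite family of
-- Left options and a finite family of Right options (with multiplicity:
-- each option corresponds to one move / one edge of the game tree).

data Game : Set where
  game : (nL : ℕ) → (Fin nL → Game) → (nR : ℕ) → (Fin nR → Game) → Game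

mkGame : List Game → List Game → Game
mkGame L R = game (length L) (lookup L) (length R) (lookup R)

data _≅_ : Game → Game → Set where
  iso : ∀ {nL nR mL mR}
          {gL : Fin nL → Game} {gR : Fin nR → Game}
          {hL : Fin mL → Game} {hR : Fin mR → Game}
        → (σL : Fin nL ↔ Fin mL)
        → (∀ i → gL i ≅ hL (Inverse.to σL i))
        → (σR : Fin nR ↔ Fin mR)
        → (∀ j → gR j ≅ hR (Inverse.to σR j))
        → game nL gL nR gR ≅ game mL hL mR hR

-- G ≤ H  iff  no G^L with H ≤ G^L and no H^R with H^R ≤ G,
-- written positively with the "less or fuzzy" relation  G ⧏ H
-- (G ⧏ H iff G ≤ some H^L or some G^R ≤ H).

mutual
  _≤g_ : Game → Game → Set
  game nL gL nR gR ≤g game mL hL mR hR =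
    (∀ i → gL i ⧏ game mL hL mR hR) × (∀ j → game nL gL nR gR ⧏ hR j)

  _⧏_ : Game → Game → Set
  game nL gL nR gR ⧏ game mL hL mR hR =
    (∃[ i ] (game nL gL nR gR ≤g hL i)) ⊎ (∃[ j ] (gR j ≤g game mL hL mR hR))

_≈g_ : Game → Game → Set
G ≈g H = (G ≤g H) × (H ≤g G)

oddℕ : ℕ → Bool
oddℕ zero = false
oddℕ (suc n) with oddℕ n
... | true  = false
... | false = true

-- Cell (c , r): column c (0 = leftmost), row r
-- (0 = bottom).  (0,0) is poisoned; otherwise the cell is blue iff
-- c + r is odd (so (1,0) and (0,1) are blue), red iff c + r is even.
-- The bar (n , m) has columns 0..n and rows 0..m.
--   * vertical cut just left of column c (1 ≤ c ≤ n): the column to the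
--     right has top square (c , m); the result is the bar (c-1 , m).
--   * horizontal cut just below row r (1 ≤ r ≤ m): the row above has
--     rightmost square (n , r); the result is the bar (n , r-1).
-- Left may make the cut iff that square is blue, Right iff it is red.
-- `chocF` uses a fuel argument (each move decreases n + m).

blueCell : ℕ → ℕ → Bool
blueCell c r = oddℕ (c + r)

chocF : ℕ → ℕ → ℕ → Game
chocF zero n m = mkGame [] []
chocF (suc f) n m = mkGame (vL ++ hL) (vR ++ hR)
  where
    vL = concatMap (λ k → if blueCell (suc k) m then [ chocF f k m ] else []) (upTo n)
    vR = concatMap (λ k → if blueCell (suc k) m then [] else [ chocF f k m ]) (upTo n)
    hL = concatMap (λ j → if blueCell n (suc j) then [ chocF f n j ] else []) (upTo m)
    hR = concatMap (λ j → if blueCell n (suc j) then [] else [ chocF f n j ]) (upTo m)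

-- the (n , m)-position: n+1 columns, m+1 rows
choc : ℕ → ℕ → Game
choc n m = chocF (suc (n + m)) n m

-- Blue-red hackenbush strings.  A string is the list of its edge
-- colours from the ground upwards.  Removing the edge at height i
-- disconnects every edge above it, leaving the first i edges.

data Colour : Set where
  blue red : Colour

cuts : List Colour → List (Colour × List Colour)
cuts [] = []
cuts (c ∷ s) = (c , []) ∷ map (λ { (d , p) → (d , c ∷ p) }) (cuts s)

hackF : ℕ → List Colour → Game
hackF zero s = mkGame [] []
hackF (suc f) s = mkGame (concatMap leftMove (cuts s)) (concatMap rightMove (cuts s))
  where
    leftMove : Colour × List Colour → List Game
    leftMove (blue , p) = [ hackF f p ]
    leftMove (red  , p) = []
    rightMove : Colour × List Colour → List Game
    rightMove (blue , p) = []
    rightMove (red  , p) = [ hackF f p ]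

hack : List Colour → Game
hack s = hackF (length s) s

altString : ℕ → List Colour
altString m = map (λ i → if oddℕ i then red else blue) (upTo m)

-- Dyadic rationals as games: dyad k a is the game value of a / 2^k
--   integers: 0 = { | }, n+1 = { n | }, -(n+1) = { | -n };
--   a odd: a/2^(k+1) = { (a-1)/2^(k+1) | (a+1)/2^(k+1) }.

intGame : ℤ → Game
intGame (+ zero) = mkGame [] []
intGame (+ suc n) = mkGame [ intGame (+ n) ] []
intGame -[1+ zero ] = mkGame [] [ intGame (+ zero) ]
intGame -[1+ suc n ] = mkGame [] [ intGame -[1+ n ] ]

oddℤ : ℤ → Bool
oddℤ (+ n) = oddℕ n
oddℤ -[1+ n ] = oddℕ (suc n)

-- floor (a / 2)
halfℤ : ℤ → ℤ
halfℤ (+ n) = + (n ℕ./ 2)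
halfℤ -[1+ n ] = -[1+ (n ℕ./ 2) ]

dyad : ℕ → ℤ → Game
dyad zero a = intGame a
dyad (suc k) a =
  if oddℤ a
  then mkGame [ dyad k (halfℤ a) ] [ dyad k (halfℤ a ℤ.+ + 1) ]
  else dyad k (halfℤ a)

powℚ : ℚ → ℕ → ℚ
powℚ q zero = ℚ.1ℚ
powℚ q (suc n) = q ℚ.* powℚ q n

_=ℚ_ : Game → ℚ → Set
G =ℚ q = Σ ℕ λ k → Σ ℤ λ a → ((a ℚ./ 1) ℚ.* powℚ ½ k ≡ q) × (G ≈g dyad k a)

-- H_m = (2^m - (-1)^m) / (3 × 2^(m-1)) = (2^m - (-1)^m) · (2/3) · (1/2)^m
Hval : ℕ → ℚ
Hval m = (powℚ (+ 2 ℚ./ 1) m ℚ.- powℚ (ℚ.- ℚ.1ℚ) m) ℚ.* (+ 2 ℚ./ 3) ℚ.* powℚ ½ m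

{-# OPTIONS --safe #-}
-- The column (0,m), the row (m,0) and the alternating string of size m are the same game tree:
-- its options are the positions of size j < m, Left's exactly when j is even. Among these,
-- column j ≤ column k for even j ≤ k and column k ≤ column j for odd j ≤ k, so the position of
-- size m+2 only needs its options of sizes m and m+1: it equals { G_m | G_m+1 } for m even and
-- { G_m+1 | G_m } for m odd. The dyadic rationals 2J_m/2^m obey the same recursion, J being the
-- Jacobsthal numbers J_m+2 = J_m+1 + 2J_m, and 3J_m = 2^m - (-1)^m identifies them with H_m.
module Submission where

open import Defs
open import Data.Bool using (Bool; true; false; if_then_else_; not)
open import Data.Bool.Properties using (if-float; not-¬)
open import Data.Fin using (Fin; zero)
open import Data.Integer as ℤ using (ℤ; +_; -[1+_]; +[1+_]; -1ℤ)
open import Data.Integer.Properties using (pos-+; pos-*) renaming (*-identityʳ to ℤ-*-identityʳ)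
open import Data.Integer.Tactic.RingSolver using (solve-∀)
open import Data.List using (List; []; _∷_; [_]; lookup; upTo; applyUpTo; concat; concatMap; map)
open import Data.List.Properties
  using (map-cong-local; map-upTo; map-applyUpTo; concatMap-map; ++-identityʳ; length-applyUpTo)
open import Data.List.Relation.Unary.All.Properties using (applyUpTo⁺₁)
open import Data.List.Relation.Unary.Any using (here; index)
open import Data.List.Relation.Unary.Any.Properties using (lookup-index)
open import Data.List.Membership.Propositional using (_∈_; find; lose)
open import Data.List.Membership.Propositional.Properties
  using (∈-lookup; ∈-upTo⁺; ∈-upTo⁻; ∈-concatMap⁺; ∈-concatMap⁻)
open import Data.Nat as ℕ using (ℕ; zero; suc; _+_; _*_; _/_; _<_; _≤_; z≤n; s≤s)
open import Data.Nat.Coprimality using (1-coprimeTo) renaming (sym to coprime-sym)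
open import Data.Nat.DivMod using (m*n/n≡m; m/n≡1+[m∸n]/n)
open import Data.Nat.Properties
  using (+-identityʳ; +-comm; *-comm; *-suc; suc-injective; <-cmp; <-≤-trans; ≤-trans; ≤-pred; ≤-refl
        ; m≤n⇒m<n∨m≡n; n≤1+n; n<1+n; m≤m+n)
open import Data.Nat.Tactic.RingSolver using () renaming (solve-∀ to ℕ-solve-∀)
open import Data.Product using (_×_; _,_; proj₁; proj₂; ∃-syntax)
open import Data.Rational as ℚ using (ℚ; mkℚ; ½)
open import Data.Rational.Properties using (↥p/↧p≡p) renaming (*-comm to ℚ-*-comm; *-assoc to ℚ-*-assoc)
open import Data.Sum using (_⊎_; inj₁; inj₂)
open import Function.Construct.Identity using (↔-id)
open import Relation.Binary.Definitions using (tri<; tri≈; tri>)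
open import Relation.Binary.PropositionalEquality
  using (_≡_; refl; sym; trans; cong; cong₂; subst; subst₂; module ≡-Reasoning)
open import Relation.Nullary using (contradiction)

⧏-leftOption : ∀ G {nL gL nR gR} (i : Fin nL) → G ≤g gL i → G ⧏ game nL gL nR gR
⧏-leftOption (game _ _ _ _) i G≤gLi = inj₁ (i , G≤gLi)

⧏-rightOption : ∀ H {nL gL nR gR} (j : Fin nR) → gR j ≤g H → game nL gL nR gR ⧏ H
⧏-rightOption (game _ _ _ _) j gRj≤H = inj₂ (j , gRj≤H)

≤g-refl : ∀ G → G ≤g G
≤g-refl (game _ gL _ gR) =
  (λ i → ⧏-leftOption (gL i) i (≤g-refl (gL i))) , (λ j → ⧏-rightOption (gR j) j (≤g-refl (gR j)))

mutual
  ≤g-trans : ∀ G H K → G ≤g H → H ≤g K → G ≤g K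
  ≤g-trans G@(game _ gL _ _) H@(game _ _ _ _) K@(game _ _ _ kR) (gL⧏H , G⧏hR) H≤K@(_ , H⧏kR) =
    (λ i → ⧏-≤g-trans (gL i) H K (gL⧏H i) H≤K) ,
    (λ j → ≤g-⧏-trans G H (kR j) (gL⧏H , G⧏hR) (H⧏kR j))

  ⧏-≤g-trans : ∀ G H K → G ⧏ H → H ≤g K → G ⧏ K
  ⧏-≤g-trans G@(game _ _ _ _) (game _ hL _ _) K@(game _ _ _ _) (inj₁ (i , G≤hLi)) (hL⧏K , _) =
    ≤g-⧏-trans G (hL i) K G≤hLi (hL⧏K i)
  ⧏-≤g-trans (game _ _ _ gR) H@(game _ _ _ _) K@(game _ _ _ _) (inj₂ (j , gRj≤H)) H≤K =
    ⧏-rightOption K j (≤g-trans (gR j) H K gRj≤H H≤K)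

  ≤g-⧏-trans : ∀ G H K → G ≤g H → H ⧏ K → G ⧏ K
  ≤g-⧏-trans G@(game _ _ _ _) H@(game _ _ _ _) (game _ kL _ _) G≤H (inj₁ (i , H≤kLi)) =
    ⧏-leftOption G i (≤g-trans G H (kL i) G≤H H≤kLi)
  ≤g-⧏-trans G@(game _ _ _ _) (game _ _ _ hR) K@(game _ _ _ _) (_ , G⧏hR) (inj₂ (j , hRj≤K)) =
    ⧏-≤g-trans G (hR j) K (G⧏hR j) hRj≤K

≈g-bestOptions : ∀ {nL gL nR gR} x y → let G = game nL gL nR gR in
  (∀ i → gL i ≤g x) → x ⧏ G → G ⧏ y → (∀ j → y ≤g gR j) → G ≈g mkGame [ x ] [ y ]
≈g-bestOptions {gL = gL} {gR = gR} x y gL≤x x⧏G G⧏y y≤gR =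
  ((λ i → ⧏-leftOption (gL i) zero (gL≤x i)) , λ { zero → G⧏y }) ,
  ((λ { zero → x⧏G }) , λ j → ⧏-rightOption (gR j) zero (y≤gR j))

≅-refl : ∀ G → G ≅ G
≅-refl (game _ gL _ gR) = iso (↔-id _) (λ i → ≅-refl (gL i)) (↔-id _) (λ j → ≅-refl (gR j))

leftOptions rightOptions : (ℕ → Bool) → (ℕ → Game) → ℕ → List Game
leftOptions  isLeft g m = concatMap (λ j → if isLeft j then [ g j ] else []) (upTo m)
rightOptions isLeft g m = concatMap (λ j → if isLeft j then [] else [ g j ]) (upTo m)

splitGame : (ℕ → Bool) → (ℕ → Game) → ℕ → Game
splitGame isLeft g m = mkGame (leftOptions isLeft g m) (rightOptions isLeft g m)

module _ {A : Set} {x y : A} where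

  ∈-ifThen⁻ : ∀ b → x ∈ (if b then [ y ] else []) → b ≡ true × x ≡ y
  ∈-ifThen⁻ true (here x≡y) = refl , x≡y

  ∈-ifElse⁻ : ∀ b → x ∈ (if b then [] else [ y ]) → b ≡ false × x ≡ y
  ∈-ifElse⁻ false (here x≡y) = refl , x≡y

module _ (isLeft : ℕ → Bool) (g : ℕ → Game) (m : ℕ) where

  ∈-leftOptions⁻ : ∀ {x} → x ∈ leftOptions isLeft g m → ∃[ j ] j < m × isLeft j ≡ true × x ≡ g j
  ∈-leftOptions⁻ x∈ with find (∈-concatMap⁻ (λ j → if isLeft j then [ g j ] else []) {xs = upTo m} x∈)
  ... | j , j∈ , x∈j with ∈-ifThen⁻ (isLeft j) x∈j
  ...   | isLeftj , x≡gj = j , ∈-upTo⁻ j∈ , isLeftj , x≡gj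

  ∈-rightOptions⁻ : ∀ {x} → x ∈ rightOptions isLeft g m → ∃[ j ] j < m × isLeft j ≡ false × x ≡ g j
  ∈-rightOptions⁻ x∈ with find (∈-concatMap⁻ (λ j → if isLeft j then [] else [ g j ]) {xs = upTo m} x∈)
  ... | j , j∈ , x∈j with ∈-ifElse⁻ (isLeft j) x∈j
  ...   | isRightj , x≡gj = j , ∈-upTo⁻ j∈ , isRightj , x≡gj

  ∈-leftOptions⁺ : ∀ {j} → j < m → isLeft j ≡ true → g j ∈ leftOptions isLeft g m
  ∈-leftOptions⁺ {j} j<m isLeftj = ∈-concatMap⁺ _ (lose (∈-upTo⁺ j<m) gj∈)
    where
      gj∈ : g j ∈ (if isLeft j then [ g j ] else [])
      gj∈ rewrite isLeftj = here refl

  ∈-rightOptions⁺ : ∀ {j} → j < m → isLeft j ≡ false → g j ∈ rightOptions isLeft g m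
  ∈-rightOptions⁺ {j} j<m isRightj = ∈-concatMap⁺ _ (lose (∈-upTo⁺ j<m) gj∈)
    where
      gj∈ : g j ∈ (if isLeft j then [] else [ g j ])
      gj∈ rewrite isRightj = here refl

  ⧏-splitGame : ∀ G {j} → j < m → isLeft j ≡ true → G ≤g g j → G ⧏ splitGame isLeft g m
  ⧏-splitGame G {j} j<m isLeftj G≤gj = ⧏-leftOption G (index gj∈) (subst (G ≤g_) (lookup-index gj∈) G≤gj)
    where
      gj∈ : g j ∈ leftOptions isLeft g m
      gj∈ = ∈-leftOptions⁺ j<m isLeftj

  splitGame-⧏ : ∀ H {j} → j < m → isLeft j ≡ false → g j ≤g H → splitGame isLeft g m ⧏ H
  splitGame-⧏ H {j} j<m isRightj gj≤H = ⧏-rightOption H (index gj∈) (subst (_≤g H) (lookup-index gj∈) gj≤H)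
    where
      gj∈ : g j ∈ rightOptions isLeft g m
      gj∈ = ∈-rightOptions⁺ j<m isRightj

  ∀-leftOptions : (P : Game → Set) → (∀ {j} → j < m → isLeft j ≡ true → P (g j)) →
                  ∀ i → P (lookup (leftOptions isLeft g m) i)
  ∀-leftOptions P Pg i with ∈-leftOptions⁻ (∈-lookup i)
  ... | j , j<m , isLeftj , x≡gj = subst P (sym x≡gj) (Pg j<m isLeftj)

  ∀-rightOptions : (P : Game → Set) → (∀ {j} → j < m → isLeft j ≡ false → P (g j)) →
                   ∀ i → P (lookup (rightOptions isLeft g m) i)
  ∀-rightOptions P Pg i with ∈-rightOptions⁻ (∈-lookup i)
  ... | j , j<m , isRightj , x≡gj = subst P (sym x≡gj) (Pg j<m isRightj)

concatMap-cong-upTo : ∀ {A : Set} {f h : ℕ → List A} m → (∀ {j} → j < m → f j ≡ h j) →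
                      concatMap f (upTo m) ≡ concatMap h (upTo m)
concatMap-cong-upTo m f≡h = cong concat (map-cong-local (applyUpTo⁺₁ _ m f≡h))

splitGame-cong : ∀ {isLeft isLeft′ g g′} m →
                 (∀ {j} → j < m → isLeft j ≡ isLeft′ j) → (∀ {j} → j < m → g j ≡ g′ j) →
                 splitGame isLeft g m ≡ splitGame isLeft′ g′ m
splitGame-cong m isLeft≡ g≡ = cong₂ mkGame
  (concatMap-cong-upTo m λ j<m → cong₂ (λ b x → if b then [ x ] else []) (isLeft≡ j<m) (g≡ j<m))
  (concatMap-cong-upTo m λ j<m → cong₂ (λ b x → if b then [] else [ x ]) (isLeft≡ j<m) (g≡ j<m))

-- F f m builds the position of size m with fuel f, as chocF and hackF do.
SplitRecursive : (ℕ → Bool) → (ℕ → ℕ → Game) → Set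
SplitRecursive isLeft F = (F 0 0 ≡ mkGame [] []) × (∀ f m → F (suc f) m ≡ splitGame isLeft (F f) m)

splitRecursive-agree : ∀ {isLeft F F′} → SplitRecursive isLeft F → SplitRecursive isLeft F′ →
                       ∀ f f′ {m} → m ≤ f → m ≤ f′ → F f m ≡ F′ f′ m
splitRecursive-agree (F0 , _) (F′0 , _) zero zero z≤n z≤n = trans F0 (sym F′0)
splitRecursive-agree (F0 , _) (_ , F′suc) zero (suc f′) z≤n _ = trans F0 (sym (F′suc f′ 0))
splitRecursive-agree (_ , Fsuc) (F′0 , _) (suc f) zero _ z≤n = trans (Fsuc f 0) (sym F′0)
splitRecursive-agree {F = F} {F′} recF@(_ , Fsuc) recF′@(_ , F′suc) (suc f) (suc f′) {m} m≤f m≤f′ =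
  trans (Fsuc f m) (trans (splitGame-cong m (λ _ → refl) agree) (sym (F′suc f′ m)))
  where
    agree : ∀ {j} → j < m → F f j ≡ F′ f′ j
    agree j<m = splitRecursive-agree recF recF′ f f′
                  (≤-pred (<-≤-trans j<m m≤f)) (≤-pred (<-≤-trans j<m m≤f′))

evenℕ : ℕ → Bool
evenℕ n = oddℕ (suc n)

evenℕ-suc : ∀ n → evenℕ (suc n) ≡ not (evenℕ n)
evenℕ-suc n with oddℕ n
... | true  = refl
... | false = refl

evenℕ-suc-not : ∀ n {b} → evenℕ n ≡ b → evenℕ (suc n) ≡ not b
evenℕ-suc-not n parity = trans (evenℕ-suc n) (cong not parity)

column : ℕ → Game
column m = choc 0 m

-- The cut leaving j+1 rows of a column is Left's iff the square (0, j+1) is blue, i.e. iff j is even.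
choc-column-splitRecursive : SplitRecursive evenℕ (λ f m → chocF f 0 m)
choc-column-splitRecursive = refl , λ f m → refl

choc-row-splitRecursive : SplitRecursive evenℕ (λ f n → chocF f n 0)
choc-row-splitRecursive = refl , λ f n →
  trans (cong₂ mkGame (++-identityʳ (leftOptions blueBottom (λ k → chocF f k 0) n))
                      (++-identityʳ (rightOptions blueBottom (λ k → chocF f k 0) n)))
        (splitGame-cong n (λ {k} _ → cong oddℕ (+-identityʳ (suc k))) (λ _ → refl))
  where
    blueBottom : ℕ → Bool
    blueBottom k = blueCell (suc k) 0

column-unfold : ∀ m → column m ≡ splitGame evenℕ column m
column-unfold m = splitGame-cong m (λ _ → refl) λ {j} j<m →
  splitRecursive-agree choc-column-splitRecursive choc-column-splitRecursive
    m (suc j) (≤-pred (<-≤-trans j<m (n≤1+n m))) (n≤1+n j)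

choc-row≡column : ∀ n → choc n 0 ≡ column n
choc-row≡column n = splitRecursive-agree choc-row-splitRecursive choc-column-splitRecursive
  (suc (n + 0)) (suc n) (≤-trans (n≤1+n n) (s≤s (m≤m+n n 0))) (n≤1+n n)

altColour : ℕ → Colour
altColour i = if oddℕ i then red else blue

altColour-evenℕ : ∀ i → altColour i ≡ (if evenℕ i then blue else red)
altColour-evenℕ i with oddℕ i
... | true  = refl
... | false = refl

cuts-applyUpTo : ∀ (h : ℕ → Colour) n → cuts (applyUpTo h n) ≡ applyUpTo (λ i → h i , applyUpTo h i) n
cuts-applyUpTo h zero = refl
cuts-applyUpTo h (suc n) = cong ((h 0 , []) ∷_)
  (trans (cong (map _) (cuts-applyUpTo (λ i → h (suc i)) n)) (map-applyUpTo _ _ n))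

concatMap-cuts-altString : ∀ {A : Set} (F : Colour × List Colour → List A) m →
  concatMap F (cuts (applyUpTo altColour m)) ≡
  concatMap (λ j → if evenℕ j then F (blue , applyUpTo altColour j) else F (red , applyUpTo altColour j)) (upTo m)
concatMap-cuts-altString F m = begin
  concatMap F (cuts (applyUpTo altColour m))
    ≡⟨ cong (concatMap F) (trans (cuts-applyUpTo altColour m) (sym (map-upTo _ m))) ⟩
  concatMap F (map (λ i → altColour i , applyUpTo altColour i) (upTo m))
    ≡⟨ concatMap-map F _ (upTo m) ⟩
  concatMap (λ j → F (altColour j , applyUpTo altColour j)) (upTo m)
    ≡⟨ concatMap-cong-upTo m (λ {j} _ → trans (cong (λ c → F (c , applyUpTo altColour j)) (altColour-evenℕ j))
                                               (if-float (λ c → F (c , applyUpTo altColour j)) (evenℕ j))) ⟩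
  concatMap (λ j → if evenℕ j then F (blue , applyUpTo altColour j) else F (red , applyUpTo altColour j)) (upTo m)
    ∎
  where open ≡-Reasoning

hack-splitRecursive : SplitRecursive evenℕ (λ f m → hackF f (applyUpTo altColour m))
hack-splitRecursive = refl , λ f m → cong₂ mkGame (concatMap-cuts-altString _ m) (concatMap-cuts-altString _ m)

hack≡column : ∀ m → hack (altString m) ≡ column m
hack≡column m rewrite map-upTo altColour m | length-applyUpTo altColour m =
  splitRecursive-agree hack-splitRecursive choc-column-splitRecursive m (suc m) ≤-refl (n≤1+n m)

⧏-column : ∀ G {j m} → j < m → evenℕ j ≡ true → G ≤g column j → G ⧏ column m
⧏-column G {m = m} j<m even-j G≤ =
  subst (G ⧏_) (sym (column-unfold m)) (⧏-splitGame evenℕ column m G j<m even-j G≤)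

column-⧏ : ∀ H {j m} → j < m → evenℕ j ≡ false → column j ≤g H → column m ⧏ H
column-⧏ H {m = m} j<m odd-j ≤H =
  subst (_⧏ H) (sym (column-unfold m)) (splitGame-⧏ evenℕ column m H j<m odd-j ≤H)

≤g-column : ∀ m n → (∀ {j} → j < m → evenℕ j ≡ true → column j ⧏ column n) →
            (∀ {k} → k < n → evenℕ k ≡ false → column m ⧏ column k) → column m ≤g column n
≤g-column m n left right = subst₂ _≤g_ (sym (column-unfold m)) (sym (column-unfold n))
  ( ∀-leftOptions evenℕ column m (_⧏ splitGame evenℕ column n)
      (λ {j} j<m even-j → subst (column j ⧏_) (column-unfold n) (left j<m even-j))
  , ∀-rightOptions evenℕ column n (splitGame evenℕ column m ⧏_)
      (λ {k} k<n odd-k → subst (_⧏ column k) (column-unfold m) (right k<n odd-k)))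

column-even⧏odd : ∀ j k → evenℕ j ≡ true → evenℕ k ≡ false → column j ⧏ column k
column-even⧏odd j k even-j odd-k with <-cmp j k
... | tri< j<k _ _ = ⧏-column (column j) j<k even-j (≤g-refl (column j))
... | tri≈ _ refl _ = contradiction (trans (sym even-j) odd-k) λ ()
... | tri> _ _ k<j = column-⧏ (column k) k<j odd-k (≤g-refl (column k))

column-even-mono : ∀ {j k} → j ≤ k → evenℕ j ≡ true → column j ≤g column k
column-even-mono {j} {k} j≤k even-j = ≤g-column j k
  (λ {i} i<j even-i → ⧏-column (column i) (<-≤-trans i<j j≤k) even-i (≤g-refl _))
  (λ {l} _ odd-l → column-even⧏odd j l even-j odd-l)

column-odd-antimono : ∀ {j k} → j ≤ k → evenℕ j ≡ false → column k ≤g column j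
column-odd-antimono {j} {k} j≤k odd-j = ≤g-column k j
  (λ {l} _ even-l → column-even⧏odd l j even-l odd-j)
  (λ {i} i<j odd-i → column-⧏ (column i) (<-≤-trans i<j j≤k) odd-i (≤g-refl (column i)))

LargestBelow : (ℕ → Set) → ℕ → ℕ → Set
LargestBelow P n e = e < n × P e × (∀ {j} → j < n → P j → j ≤ e)

column-≈g-bestOptions : ∀ {n e o} x y →
  LargestBelow (λ j → evenℕ j ≡ true) n e → LargestBelow (λ k → evenℕ k ≡ false) n o →
  column e ≈g x → column o ≈g y → column n ≈g mkGame [ x ] [ y ]
column-≈g-bestOptions {n} {e} {o} x y (e<n , even-e , e-max) (o<n , odd-o , o-max) (e≤x , x≤e) (o≤y , y≤o) =
  subst (_≈g mkGame [ x ] [ y ]) (sym (column-unfold n)) (≈g-bestOptions x y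
    (∀-leftOptions evenℕ column n (_≤g x)
      λ {j} j<n even-j → ≤g-trans (column j) (column e) x (column-even-mono (e-max j<n even-j) even-j) e≤x)
    (subst (x ⧏_) (column-unfold n) (⧏-column x e<n even-e x≤e))
    (subst (_⧏ y) (column-unfold n) (column-⧏ y o<n odd-o o≤y))
    (∀-rightOptions evenℕ column n (y ≤g_)
      λ {k} k<n odd-k → ≤g-trans y (column o) (column k) y≤o (column-odd-antimono (o-max k<n odd-k) odd-k)))

last-largestBelow : ∀ {b} m → evenℕ m ≡ b → LargestBelow (λ j → evenℕ j ≡ b) (suc m) m
last-largestBelow m parity = n<1+n m , parity , λ j<1+m _ → ≤-pred j<1+m

penultimate-largestBelow : ∀ {b} m → evenℕ m ≡ b → LargestBelow (λ j → evenℕ j ≡ b) (suc (suc m)) m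
penultimate-largestBelow {b} m parity = s≤s (n≤1+n m) , parity , below
  where
    below : ∀ {j} → j < suc (suc m) → evenℕ j ≡ b → j ≤ m
    below (s≤s j≤1+m) parity-j with m≤n⇒m<n∨m≡n j≤1+m
    ... | inj₁ j<1+m = ≤-pred j<1+m
    ... | inj₂ refl  = contradiction (trans (sym parity-j) (evenℕ-suc-not m parity)) (not-¬ refl)

jacobsthal : ℕ → ℕ
jacobsthal zero = 0
jacobsthal (suc zero) = 1
jacobsthal (suc (suc m)) = jacobsthal (suc m) + 2 * jacobsthal m

jacobsthal-suc : ∀ m → (evenℕ m ≡ true → jacobsthal (suc m) ≡ suc (2 * jacobsthal m))
                     × (evenℕ m ≡ false → suc (jacobsthal (suc m)) ≡ 2 * jacobsthal m)
jacobsthal-suc zero = (λ _ → refl) , (λ ())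
jacobsthal-suc (suc m) rewrite evenℕ-suc m with evenℕ m | jacobsthal-suc m
... | true | (even-step , _) = (λ ()) , λ _ → begin
    suc (jacobsthal (suc m) + 2 * jacobsthal m)   ≡⟨ cong (λ J → suc (J + 2 * jacobsthal m)) (even-step refl) ⟩
    suc (suc (2 * jacobsthal m) + 2 * jacobsthal m) ≡⟨ double-odd (jacobsthal m) ⟩
    2 * suc (2 * jacobsthal m)                     ≡⟨ cong (2 *_) (sym (even-step refl)) ⟩
    2 * jacobsthal (suc m)                         ∎
  where
    open ≡-Reasoning
    double-odd : ∀ x → suc (suc (2 * x) + 2 * x) ≡ 2 * suc (2 * x)
    double-odd = ℕ-solve-∀
... | false | (_ , odd-step) = (λ _ → begin
    jacobsthal (suc m) + 2 * jacobsthal m           ≡⟨ cong (λ J → jacobsthal (suc m) + J) (sym (odd-step refl)) ⟩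
    jacobsthal (suc m) + suc (jacobsthal (suc m))   ≡⟨ +-suc-double (jacobsthal (suc m)) ⟩
    suc (2 * jacobsthal (suc m))                    ∎) , (λ ())
  where
    open ≡-Reasoning
    +-suc-double : ∀ x → x + suc x ≡ suc (2 * x)
    +-suc-double = ℕ-solve-∀

oddℕ-suc-suc : ∀ n → oddℕ (suc (suc n)) ≡ oddℕ n
oddℕ-suc-suc n with oddℕ n
... | true  = refl
... | false = refl

oddℕ-double : ∀ x → oddℕ (2 * x) ≡ false
oddℕ-double zero = refl
oddℕ-double (suc x) = trans (cong oddℕ (*-suc 2 x)) (trans (oddℕ-suc-suc (2 * x)) (oddℕ-double x))

oddℕ-suc-double : ∀ x → oddℕ (suc (2 * x)) ≡ true
oddℕ-suc-double x rewrite oddℕ-double x = refl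

half-double : ∀ x → 2 * x / 2 ≡ x
half-double x = trans (cong (_/ 2) (*-comm 2 x)) (m*n/n≡m x 2)

half-suc-double : ∀ x → suc (2 * x) / 2 ≡ x
half-suc-double zero = refl
half-suc-double (suc x) = begin
  suc (2 * suc x) / 2         ≡⟨ cong (λ y → suc y / 2) (*-suc 2 x) ⟩
  suc (suc (suc (2 * x))) / 2 ≡⟨ m/n≡1+[m∸n]/n {suc (suc (suc (2 * x)))} {2} (s≤s (s≤s z≤n)) ⟩
  suc (suc (2 * x) / 2)       ≡⟨ cong suc (half-suc-double x) ⟩
  suc x                       ∎
  where open ≡-Reasoning

dyad-double : ∀ k x → dyad (suc k) (+ (2 * x)) ≡ dyad k (+ x)
dyad-double k x rewrite oddℕ-double x | half-double x = refl

dyad-suc-double : ∀ k x → dyad (suc k) (+ suc (2 * x)) ≡ mkGame [ dyad k (+ x) ] [ dyad k (+ suc x) ]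
dyad-suc-double k x rewrite oddℕ-suc-double x | half-suc-double x | +-comm x 1 = refl

-- The dyadic game of 2 J_m / 2^m, which is H_m.
Hdyad : ℕ → Game
Hdyad m = dyad m (+ (2 * jacobsthal m))

Hdyad-suc : ∀ m → Hdyad (suc m) ≡ dyad m (+ jacobsthal (suc m))
Hdyad-suc m = dyad-double m (jacobsthal (suc m))

Hdyad-even : ∀ m → evenℕ m ≡ true → Hdyad (suc (suc m)) ≡ mkGame [ Hdyad m ] [ Hdyad (suc m) ]
Hdyad-even m even-m = begin
  Hdyad (suc (suc m))                                                ≡⟨ Hdyad-suc (suc m) ⟩
  dyad (suc m) (+ jacobsthal (suc (suc m)))                          ≡⟨ cong (λ J → dyad (suc m) (+ J)) J₂ ⟩
  dyad (suc m) (+ suc (2 * (2 * jacobsthal m)))                      ≡⟨ dyad-suc-double m (2 * jacobsthal m) ⟩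
  mkGame [ Hdyad m ] [ dyad m (+ suc (2 * jacobsthal m)) ]           ≡⟨ cong (λ G → mkGame [ Hdyad m ] [ G ]) H₁ ⟩
  mkGame [ Hdyad m ] [ Hdyad (suc m) ]                               ∎
  where
    open ≡-Reasoning
    J₁ : jacobsthal (suc m) ≡ suc (2 * jacobsthal m)
    J₁ = proj₁ (jacobsthal-suc m) even-m
    J₂ : jacobsthal (suc (suc m)) ≡ suc (2 * (2 * jacobsthal m))
    J₂ = suc-injective (begin
      suc (jacobsthal (suc (suc m)))  ≡⟨ proj₂ (jacobsthal-suc (suc m)) (evenℕ-suc-not m even-m) ⟩
      2 * jacobsthal (suc m)          ≡⟨ cong (2 *_) J₁ ⟩
      2 * suc (2 * jacobsthal m)      ≡⟨ *-suc 2 (2 * jacobsthal m) ⟩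
      suc (suc (2 * (2 * jacobsthal m))) ∎)
    H₁ : dyad m (+ suc (2 * jacobsthal m)) ≡ Hdyad (suc m)
    H₁ = sym (trans (Hdyad-suc m) (cong (λ J → dyad m (+ J)) J₁))

Hdyad-odd : ∀ m → evenℕ m ≡ false → Hdyad (suc (suc m)) ≡ mkGame [ Hdyad (suc m) ] [ Hdyad m ]
Hdyad-odd m odd-m = begin
  Hdyad (suc (suc m))                                                  ≡⟨ Hdyad-suc (suc m) ⟩
  dyad (suc m) (+ jacobsthal (suc (suc m)))                            ≡⟨ cong (λ J → dyad (suc m) (+ J)) J₂ ⟩
  dyad (suc m) (+ suc (2 * jacobsthal (suc m)))                        ≡⟨ dyad-suc-double m (jacobsthal (suc m)) ⟩
  mkGame [ dyad m (+ jacobsthal (suc m)) ] [ dyad m (+ suc (jacobsthal (suc m))) ]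
    ≡⟨ cong₂ (λ G G′ → mkGame [ G ] [ G′ ])
             (sym (Hdyad-suc m)) (cong (λ J → dyad m (+ J)) (proj₂ (jacobsthal-suc m) odd-m)) ⟩
  mkGame [ Hdyad (suc m) ] [ Hdyad m ]                                 ∎
  where
    open ≡-Reasoning
    J₂ : jacobsthal (suc (suc m)) ≡ suc (2 * jacobsthal (suc m))
    J₂ = proj₁ (jacobsthal-suc (suc m)) (evenℕ-suc-not m odd-m)

column≈Hdyad-step : ∀ m → column m ≈g Hdyad m → column (suc m) ≈g Hdyad (suc m) →
                    column (suc (suc m)) ≈g Hdyad (suc (suc m))
column≈Hdyad-step m ≈₀ ≈₁ with evenℕ m in parity
... | true  = subst (column (suc (suc m)) ≈g_) (sym (Hdyad-even m parity))
                (column-≈g-bestOptions (Hdyad m) (Hdyad (suc m))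
                  (penultimate-largestBelow m parity) (last-largestBelow (suc m) (evenℕ-suc-not m parity)) ≈₀ ≈₁)
... | false = subst (column (suc (suc m)) ≈g_) (sym (Hdyad-odd m parity))
                (column-≈g-bestOptions (Hdyad (suc m)) (Hdyad m)
                  (last-largestBelow (suc m) (evenℕ-suc-not m parity)) (penultimate-largestBelow m parity) ≈₁ ≈₀)

column≈Hdyad : ∀ m → column m ≈g Hdyad m × column (suc m) ≈g Hdyad (suc m)
column≈Hdyad zero = (≤g-refl (column 0) , ≤g-refl (column 0)) , (≤g-refl (column 1) , ≤g-refl (column 1))
column≈Hdyad (suc m) = let (≈₀ , ≈₁) = column≈Hdyad m in ≈₁ , column≈Hdyad-step m ≈₀ ≈₁

/1≡mkℚ : ∀ a → a ℚ./ 1 ≡ mkℚ a 0 (coprime-sym (1-coprimeTo ℤ.∣ a ∣))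
/1≡mkℚ a = ↥p/↧p≡p (mkℚ a 0 (coprime-sym (1-coprimeTo ℤ.∣ a ∣)))

/1-homo-+ : ∀ a b → (a ℚ./ 1) ℚ.+ (b ℚ./ 1) ≡ (a ℤ.+ b) ℚ./ 1
/1-homo-+ a b rewrite /1≡mkℚ a | /1≡mkℚ b =
  cong (ℚ._/ 1) (cong₂ ℤ._+_ (ℤ-*-identityʳ a) (ℤ-*-identityʳ b))

/1-homo-* : ∀ a b → (a ℚ./ 1) ℚ.* (b ℚ./ 1) ≡ (a ℤ.* b) ℚ./ 1
/1-homo-* a b rewrite /1≡mkℚ a | /1≡mkℚ b = refl

/1-homo-- : ∀ a → ℚ.- (a ℚ./ 1) ≡ (ℤ.- a) ℚ./ 1
/1-homo-- a rewrite /1≡mkℚ a | /1≡mkℚ (ℤ.- a) with a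
... | + zero   = refl
... | +[1+ n ] = refl
... | -[1+ n ] = refl

powℚ-/1 : ∀ a m → powℚ (a ℚ./ 1) m ≡ (a ℤ.^ m) ℚ./ 1
powℚ-/1 a zero = refl
powℚ-/1 a (suc m) = trans (cong ((a ℚ./ 1) ℚ.*_) (powℚ-/1 a m)) (/1-homo-* a (a ℤ.^ m))

jacobsthal-closedForm : ∀ m → (+ 2) ℤ.^ m ℤ.- -1ℤ ℤ.^ m ≡ + 3 ℤ.* + jacobsthal m
jacobsthal-closedForm zero = refl
jacobsthal-closedForm (suc zero) = refl
jacobsthal-closedForm (suc (suc m)) = begin
  + 2 ℤ.* (+ 2 ℤ.* t) ℤ.- -1ℤ ℤ.* (-1ℤ ℤ.* s)     ≡⟨ split t s ⟩
  (+ 2 ℤ.* t ℤ.- -1ℤ ℤ.* s) ℤ.+ + 2 ℤ.* (t ℤ.- s)  ≡⟨ cong₂ (λ x y → x ℤ.+ + 2 ℤ.* y)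
                                                          (jacobsthal-closedForm (suc m)) (jacobsthal-closedForm m) ⟩
  + 3 ℤ.* J₁ ℤ.+ + 2 ℤ.* (+ 3 ℤ.* J₀)              ≡⟨ factor J₀ J₁ ⟩
  + 3 ℤ.* (J₁ ℤ.+ + 2 ℤ.* J₀)                      ≡⟨ cong (+ 3 ℤ.*_) (sym cast) ⟩
  + 3 ℤ.* + jacobsthal (suc (suc m))               ∎
  where
    open ≡-Reasoning
    t s J₀ J₁ : ℤ
    t = (+ 2) ℤ.^ m
    s = -1ℤ ℤ.^ m
    J₀ = + jacobsthal m
    J₁ = + jacobsthal (suc m)
    cast : + jacobsthal (suc (suc m)) ≡ J₁ ℤ.+ + 2 ℤ.* J₀
    cast = trans (pos-+ (jacobsthal (suc m)) (2 ℕ.* jacobsthal m)) (cong (λ y → J₁ ℤ.+ y) (pos-* 2 (jacobsthal m)))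
    split : ∀ t s → + 2 ℤ.* (+ 2 ℤ.* t) ℤ.- -1ℤ ℤ.* (-1ℤ ℤ.* s) ≡
                    (+ 2 ℤ.* t ℤ.- -1ℤ ℤ.* s) ℤ.+ + 2 ℤ.* (t ℤ.- s)
    split = solve-∀
    factor : ∀ J₀ J₁ → + 3 ℤ.* J₁ ℤ.+ + 2 ℤ.* (+ 3 ℤ.* J₀) ≡ + 3 ℤ.* (J₁ ℤ.+ + 2 ℤ.* J₀)
    factor = solve-∀

Hval-jacobsthal : ∀ m → (+ (2 ℕ.* jacobsthal m) ℚ./ 1) ℚ.* powℚ ½ m ≡ Hval m
Hval-jacobsthal m = cong (ℚ._* powℚ ½ m) (sym (begin
  (powℚ (+ 2 ℚ./ 1) m ℚ.- powℚ (-1ℤ ℚ./ 1) m) ℚ.* (+ 2 ℚ./ 3)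
    ≡⟨ cong₂ (λ x y → (x ℚ.- y) ℚ.* (+ 2 ℚ./ 3)) (powℚ-/1 (+ 2) m) (powℚ-/1 -1ℤ m) ⟩
  (((+ 2) ℤ.^ m) ℚ./ 1 ℚ.+ ℚ.- ((-1ℤ ℤ.^ m) ℚ./ 1)) ℚ.* (+ 2 ℚ./ 3)
    ≡⟨ cong (λ x → ((+ 2) ℤ.^ m ℚ./ 1 ℚ.+ x) ℚ.* (+ 2 ℚ./ 3)) (/1-homo-- (-1ℤ ℤ.^ m)) ⟩
  (((+ 2) ℤ.^ m) ℚ./ 1 ℚ.+ (ℤ.- (-1ℤ ℤ.^ m)) ℚ./ 1) ℚ.* (+ 2 ℚ./ 3)
    ≡⟨ cong (ℚ._* (+ 2 ℚ./ 3)) (/1-homo-+ ((+ 2) ℤ.^ m) (ℤ.- (-1ℤ ℤ.^ m))) ⟩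
  (((+ 2) ℤ.^ m ℤ.- -1ℤ ℤ.^ m) ℚ./ 1) ℚ.* (+ 2 ℚ./ 3)
    ≡⟨ cong (λ x → (x ℚ./ 1) ℚ.* (+ 2 ℚ./ 3)) (jacobsthal-closedForm m) ⟩
  ((+ 3 ℤ.* + jacobsthal m) ℚ./ 1) ℚ.* (+ 2 ℚ./ 3)
    ≡⟨ cong (ℚ._* (+ 2 ℚ./ 3)) (sym (/1-homo-* (+ 3) (+ jacobsthal m))) ⟩
  ((+ 3 ℚ./ 1) ℚ.* J) ℚ.* (+ 2 ℚ./ 3)
    ≡⟨ ℚ-*-comm ((+ 3 ℚ./ 1) ℚ.* J) (+ 2 ℚ./ 3) ⟩
  (+ 2 ℚ./ 3) ℚ.* ((+ 3 ℚ./ 1) ℚ.* J)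
    ≡⟨ sym (ℚ-*-assoc (+ 2 ℚ./ 3) (+ 3 ℚ./ 1) J) ⟩
  (+ 2 ℚ./ 1) ℚ.* J
    ≡⟨ /1-homo-* (+ 2) (+ jacobsthal m) ⟩
  (+ 2 ℤ.* + jacobsthal m) ℚ./ 1
    ≡⟨ cong (ℚ._/ 1) (sym (pos-* 2 (jacobsthal m))) ⟩
  + (2 ℕ.* jacobsthal m) ℚ./ 1 ∎))
  where
    open ≡-Reasoning
    J : ℚ
    J = + jacobsthal m ℚ./ 1

column-position : ∀ m G → G ≡ choc 0 m ⊎ G ≡ choc m 0 → G ≡ column m
column-position m G (inj₁ G≡) = G≡
column-position m G (inj₂ G≡) = trans G≡ (choc-row≡column m)

theorem5 : (m : ℕ) (G : Game) → (G ≡ choc 0 m ⊎ G ≡ choc m 0)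
           → (G ≅ hack (altString m)) × (G =ℚ Hval m)
theorem5 m G position with column-position m G position
... | refl = subst (column m ≅_) (sym (hack≡column m)) (≅-refl (column m)) ,
             (m , + (2 * jacobsthal m) , Hval-jacobsthal m , proj₁ (column≈Hdyad m))
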